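{- Let $b\ge2$ be an integer with $b\equiv 87\pmod{11184810}$ and let $t$ be a positive integer with $t\equiv 59\pmod{120}$. Then the $b$-repdigit $41_b^{(t)}=41(b^t-1)/(b-1)$ is a Sierpiński number.
   Context: For integers $b\ge2$, $1\le k<b$, $t\ge1$, the $b$-repdigit $k_b^{(t)}$ is $k(b^t-1)/(b-1)$. A Sierpiński number is an odd positive integer $k$ such that $k\cdot 2^n+1$ is composite for all positive integers $n$. -}

module Defs where

open import Data.Nat using (ℕ; zero; suc; _+_; _*_; _∸_; _^_; _≤_; _%_; _/_)
open import Data.Nat.Primality using (Composite)
open import Relation.Binary.PropositionalEquality using (_≡_)

-- b-repdigit k_b^(t) = k (b^t - 1) / (b - 1), meaningful for b ≥ 2.
-- (For b < 2 we return 0; the theorem only uses b ≥ 2.)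
repdigit : ℕ → ℕ → ℕ → ℕ
repdigit zero          k t = 0
repdigit (suc zero)    k t = 0
repdigit (suc (suc c)) k t = (k * ((suc (suc c)) ^ t ∸ 1)) / (suc c)

Sierpinski : ℕ → Set
Sierpinski k = (k % 2 ≡ 1) × (1 ≤ k) × ((n : ℕ) → 1 ≤ n → Composite (k * 2 ^ n + 1))
  where open import Data.Product using (_×_)

{-# OPTIONS --safe #-}
-- N = 41·R_b(t) with R_b(t) = 1 + b + ⋯ + b^(t−1). Modulo K = 11184810 = 2·3·5·7·13·17·241
-- the repunit depends only on b mod K and t mod 120, so N ≡ 41·R_87(59) (mod K); in particular
-- N is odd.
-- Since 2^24 ≡ 1 modulo 3·5·7·13·17·241, the class of n mod 24 decides which of the primes
-- 3, 5, 7, 13, 17, 241 divides N·2^n + 1, and these classes cover all n.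
module Submission where

open import Data.Fin using (Fin; toℕ; fromℕ<)
open import Data.Fin.Properties using (all?; toℕ-fromℕ<)
open import Data.Nat
open import Data.Nat.DivMod hiding (_mod_)
open import Data.Nat.Divisibility
open import Data.Nat.Primality using (Composite)
open import Data.Nat.Properties
open import Data.Nat.Solver using (module +-*-Solver)
open import Data.Product using (_×_; _,_)
open import Data.Vec using ([]; _∷_; lookup)
open import Level using (0ℓ)
open import Relation.Binary.Bundles using (Setoid)
open import Relation.Binary.PropositionalEquality
import Relation.Binary.Reasoning.Setoid as SetoidReasoning
open import Relation.Nullary.Decidable using (from-yes; _×-dec_)

open import Defs

open +-*-Solver using (solve; _:=_; _:+_; _:*_; con)

infix 4 _≡_mod_

-- A record rather than a synonym for a % m ≡ b % m: the latter would be unfolded during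
-- unification, and a, b could no longer be inferred from it.

record _≡_mod_ (a b m : ℕ) .{{_ : NonZero m}} : Set where
  constructor mk≡mod
  field residues : a % m ≡ b % m

open _≡_mod_

module _ {m : ℕ} .{{_ : NonZero m}} where

  ≡-mod-setoid : Setoid 0ℓ 0ℓ
  ≡-mod-setoid = record
    { Carrier       = ℕ
    ; _≈_           = λ a b → a ≡ b mod m
    ; isEquivalence = record
      { refl  = mk≡mod refl
      ; sym   = λ a≡b → mk≡mod (sym (residues a≡b))
      ; trans = λ a≡b b≡c → mk≡mod (trans (residues a≡b) (residues b≡c))
      }
    }

  module ≡-mod-Reasoning = SetoidReasoning ≡-mod-setoid

  +-cong-mod : ∀ {a b c d} → a ≡ b mod m → c ≡ d mod m → a + c ≡ b + d mod m
  +-cong-mod {a} {b} {c} {d} (mk≡mod a≡b) (mk≡mod c≡d) = mk≡mod (begin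
    (a + c) % m          ≡⟨ %-distribˡ-+ a c m ⟩
    (a % m + c % m) % m  ≡⟨ cong₂ (λ x y → (x + y) % m) a≡b c≡d ⟩
    (b % m + d % m) % m  ≡⟨ %-distribˡ-+ b d m ⟨
    (b + d) % m          ∎)
    where open ≡-Reasoning

  *-cong-mod : ∀ {a b c d} → a ≡ b mod m → c ≡ d mod m → a * c ≡ b * d mod m
  *-cong-mod {a} {b} {c} {d} (mk≡mod a≡b) (mk≡mod c≡d) = mk≡mod (begin
    (a * c) % m            ≡⟨ %-distribˡ-* a c m ⟩
    (a % m * (c % m)) % m  ≡⟨ cong₂ (λ x y → (x * y) % m) a≡b c≡d ⟩
    (b % m * (d % m)) % m  ≡⟨ %-distribˡ-* b d m ⟨
    (b * d) % m            ∎)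
    where open ≡-Reasoning

  *-congˡ-mod : ∀ a {b c} → b ≡ c mod m → a * b ≡ a * c mod m
  *-congˡ-mod a = *-cong-mod {a} (mk≡mod refl)

  ^-congˡ-mod : ∀ {a b} n → a ≡ b mod m → a ^ n ≡ b ^ n mod m
  ^-congˡ-mod zero    a≡b = mk≡mod refl
  ^-congˡ-mod (suc n) a≡b = *-cong-mod a≡b (^-congˡ-mod n a≡b)

  ^-mod-period : ∀ a L n .{{_ : NonZero L}} → a ^ L ≡ 1 mod m → a ^ n ≡ a ^ (n % L) mod m
  ^-mod-period a L n aᴸ≡1 = begin
    a ^ n                            ≡⟨ cong (a ^_) (m≡m%n+[m/n]*n n L) ⟩
    a ^ (n % L + n / L * L)          ≡⟨ ^-distribˡ-+-* a (n % L) (n / L * L) ⟩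
    a ^ (n % L) * a ^ (n / L * L)    ≡⟨ cong (λ k → a ^ (n % L) * a ^ k) (*-comm (n / L) L) ⟩
    a ^ (n % L) * a ^ (L * (n / L))  ≡⟨ cong (a ^ (n % L) *_) (^-*-assoc a L (n / L)) ⟨
    a ^ (n % L) * (a ^ L) ^ (n / L)  ≈⟨ *-congˡ-mod (a ^ (n % L)) (^-congˡ-mod (n / L) aᴸ≡1) ⟩
    a ^ (n % L) * 1 ^ (n / L)        ≡⟨ cong (a ^ (n % L) *_) (^-zeroˡ (n / L)) ⟩
    a ^ (n % L) * 1                  ≡⟨ *-identityʳ (a ^ (n % L)) ⟩
    a ^ (n % L)                      ∎
    where open ≡-mod-Reasoning

  ≡-mod-∣ : ∀ {a b d} .{{_ : NonZero d}} → d ∣ m → a ≡ b mod m → a ≡ b mod d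
  ≡-mod-∣ {a} {b} {d} d∣m (mk≡mod a≡b) = mk≡mod (begin
    a % d      ≡⟨ m∣n⇒o%n%m≡o%m d m a d∣m ⟨
    a % m % d  ≡⟨ cong (_% d) a≡b ⟩
    b % m % d  ≡⟨ m∣n⇒o%n%m≡o%m d m b d∣m ⟩
    b % d      ∎)
    where open ≡-Reasoning

  ∣-resp-≡-mod : ∀ {a b} → a ≡ b mod m → m ∣ b → m ∣ a
  ∣-resp-≡-mod {a} {b} (mk≡mod a≡b) m∣b = m%n≡0⇒n∣m a m (trans a≡b (n∣m⇒m%n≡0 b m m∣b))

repunit : ℕ → ℕ → ℕ
repunit b zero    = 0
repunit b (suc t) = 1 + b * repunit b t

repunit-geometric : ∀ c t → c * repunit (suc c) t + 1 ≡ suc c ^ t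
repunit-geometric c zero    = cong (_+ 1) (*-zeroʳ c)
repunit-geometric c (suc t) = begin
  c * (1 + suc c * repunit (suc c) t) + 1  ≡⟨ solve 2 (λ c r → c :* (con 1 :+ (con 1 :+ c) :* r) :+ con 1
                                                          := (con 1 :+ c) :* (c :* r :+ con 1)) refl c (repunit (suc c) t) ⟩
  suc c * (c * repunit (suc c) t + 1)      ≡⟨ cong (suc c *_) (repunit-geometric c t) ⟩
  suc c * suc c ^ t                        ∎
  where open ≡-Reasoning

repdigit≡k*repunit : ∀ b k t → 2 ≤ b → repdigit b k t ≡ k * repunit b t
repdigit≡k*repunit (suc zero)    k t (s≤s ())
repdigit≡k*repunit (suc (suc c)) k t _ = begin
  k * ((2 + c) ^ t ∸ 1) / suc c                    ≡⟨ cong (λ x → k * (x ∸ 1) / suc c) (repunit-geometric (suc c) t) ⟨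
  k * (suc c * repunit (2 + c) t + 1 ∸ 1) / suc c  ≡⟨ cong (λ x → k * x / suc c) (m+n∸n≡m (suc c * repunit (2 + c) t) 1) ⟩
  k * (suc c * repunit (2 + c) t) / suc c          ≡⟨ cong (_/ suc c) (solve 3 (λ k c r → k :* ((con 1 :+ c) :* r) := (k :* r) :* (con 1 :+ c))
                                                                         refl k c (repunit (2 + c) t)) ⟩
  k * repunit (2 + c) t * suc c / suc c            ≡⟨ m*n/n≡m (k * repunit (2 + c) t) (suc c) ⟩
  k * repunit (2 + c) t                            ∎
  where open ≡-Reasoning

repunit-+ : ∀ b s t → repunit b (s + t) ≡ repunit b s + b ^ s * repunit b t
repunit-+ b zero    t = sym (+-identityʳ (repunit b t))
repunit-+ b (suc s) t = begin
  1 + b * repunit b (s + t)                        ≡⟨ cong (λ x → 1 + b * x) (repunit-+ b s t) ⟩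
  1 + b * (repunit b s + b ^ s * repunit b t)      ≡⟨ solve 4 (λ b r p u → con 1 :+ b :* (r :+ p :* u) := (con 1 :+ b :* r) :+ (b :* p) :* u)
                                                          refl b (repunit b s) (b ^ s) (repunit b t) ⟩
  (1 + b * repunit b s) + b * b ^ s * repunit b t  ∎
  where open ≡-Reasoning

repunit-* : ∀ b s t → repunit b (s * t) ≡ repunit b s * repunit (b ^ s) t
repunit-* b s zero    = trans (cong (repunit b) (*-zeroʳ s)) (sym (*-zeroʳ (repunit b s)))
repunit-* b s (suc t) = begin
  repunit b (s * suc t)                                    ≡⟨ cong (repunit b) (*-suc s t) ⟩
  repunit b (s + s * t)                                    ≡⟨ repunit-+ b s (s * t) ⟩
  repunit b s + b ^ s * repunit b (s * t)                  ≡⟨ cong (λ x → repunit b s + b ^ s * x) (repunit-* b s t) ⟩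
  repunit b s + b ^ s * (repunit b s * repunit (b ^ s) t)  ≡⟨ solve 3 (λ r p u → r :+ p :* (r :* u) := r :* (con 1 :+ p :* u))
                                                                  refl (repunit b s) (b ^ s) (repunit (b ^ s) t) ⟩
  repunit b s * (1 + b ^ s * repunit (b ^ s) t)            ∎
  where open ≡-Reasoning

module _ {m : ℕ} .{{_ : NonZero m}} where

  repunit-congˡ-mod : ∀ {a b} t → a ≡ b mod m → repunit a t ≡ repunit b t mod m
  repunit-congˡ-mod zero    a≡b = mk≡mod refl
  repunit-congˡ-mod (suc t) a≡b = +-cong-mod (mk≡mod refl) (*-cong-mod a≡b (repunit-congˡ-mod t a≡b))

  repunit-periodic : ∀ b r p t .{{_ : NonZero p}} → m ∣ b ^ r * repunit b p → t % p ≡ r →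
                     repunit b t ≡ repunit b r mod m
  repunit-periodic b r p t m∣bʳRₚ t%p≡r = begin
    repunit b t                                    ≡⟨ cong (repunit b) (m≡m%n+[m/n]*n t p) ⟩
    repunit b (t % p + t / p * p)                  ≡⟨ cong (λ k → repunit b (k + t / p * p)) t%p≡r ⟩
    repunit b (r + t / p * p)                      ≡⟨ cong (λ k → repunit b (r + k)) (*-comm (t / p) p) ⟩
    repunit b (r + p * (t / p))                    ≡⟨ repunit-+ b r (p * (t / p)) ⟩
    repunit b r + b ^ r * repunit b (p * (t / p))  ≈⟨ mk≡mod (%-remove-+ʳ (repunit b r) m∣tail) ⟩
    repunit b r                                    ∎
    where
    open ≡-mod-Reasoning
    m∣tail : m ∣ b ^ r * repunit b (p * (t / p))
    m∣tail = subst (m ∣_) (trans (*-assoc (b ^ r) (repunit b p) (repunit (b ^ p) (t / p)))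
                                 (cong (b ^ r *_) (sym (repunit-* b p (t / p)))))
                   (∣m⇒∣m*n (repunit (b ^ p) (t / p)) m∣bʳRₚ)

coveringPrime⇒composite : ∀ {N r M p} L n .{{_ : NonZero M}} .{{_ : NonZero L}} →
                          2 ^ L ≡ 1 mod M → N ≡ r mod M → 1 < p → p ≤ N → p ∣ M → p ∣ r * 2 ^ (n % L) + 1 →
                          Composite (N * 2 ^ n + 1)
coveringPrime⇒composite {N} {r} {M} {p} L n 2ᴸ≡1 N≡r 1<p p≤N p∣M p∣r2ʲ+1 =
  hasNonTrivialDivisor {{n>1⇒nonTrivial 1<p}} p<N2ⁿ+1 (∣-resp-≡-mod (≡-mod-∣ p∣M N2ⁿ+1≡r2ʲ+1) p∣r2ʲ+1)
  where
  instance
    p≢0 : NonZero p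
    p≢0 = >-nonZero (<-trans z<s 1<p)
  p<N2ⁿ+1 : p < N * 2 ^ n + 1
  p<N2ⁿ+1 = ≤-<-trans (≤-trans p≤N (m≤m*n N (2 ^ n) {{m^n≢0 2 n}})) (m<m+n (N * 2 ^ n) z<s)
  N2ⁿ+1≡r2ʲ+1 : N * 2 ^ n + 1 ≡ r * 2 ^ (n % L) + 1 mod M
  N2ⁿ+1≡r2ʲ+1 = +-cong-mod (*-cong-mod N≡r (^-mod-period 2 L n 2ᴸ≡1)) (mk≡mod refl)

sierpinskiResidue : ℕ
sierpinskiResidue = 41 * repunit 87 59 % 11184810

coveringPrime : Fin 24 → ℕ
coveringPrime = lookup (3 ∷ 5 ∷ 3 ∷ 241 ∷ 3 ∷ 5 ∷ 3 ∷ 13 ∷ 3 ∷ 5 ∷ 3 ∷ 7 ∷ 3 ∷ 5 ∷ 3 ∷ 17 ∷ 3 ∷ 5 ∷ 3 ∷ 13 ∷ 3 ∷ 5 ∷ 3 ∷ 7 ∷ [])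

-- 5592405 = 3·5·7·13·17·241 = (2^24 − 1)/3.
coveringPrime-covers : ∀ j → let p = coveringPrime j; r = sierpinskiResidue in
                       1 < p × p ≤ r × p ∣ 5592405 × p ∣ r * 2 ^ toℕ j + 1
coveringPrime-covers = from-yes (all? λ j → let p = coveringPrime j; r = sierpinskiResidue in
                         1 <? p ×-dec p ≤? r ×-dec p ∣? 5592405 ×-dec p ∣? r * 2 ^ toℕ j + 1)

sierpinski-residue-class : ∀ N → N ≡ sierpinskiResidue mod 11184810 → Sierpinski N
sierpinski-residue-class N N≡r = odd , ≤-trans (s≤s z≤n) r≤N , λ n _ → composite-at n
  where
  r = sierpinskiResidue
  r≤N : r ≤ N
  r≤N = subst (_≤ N) (residues N≡r) (m%n≤m N 11184810)
  odd : N % 2 ≡ 1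
  odd = residues (≡-mod-∣ (divides 5592405 refl) N≡r)
  composite-at : ∀ n → Composite (N * 2 ^ n + 1)
  composite-at n =
    let n%24<24 = m%n<n n 24
        j = fromℕ< n%24<24
        (1<p , p≤r , p∣M , p∣r2ʲ+1) = coveringPrime-covers j
    in coveringPrime⇒composite 24 n (mk≡mod refl) (≡-mod-∣ (divides 2 refl) N≡r) 1<p (≤-trans p≤r r≤N) p∣M
         (subst (λ k → coveringPrime j ∣ r * 2 ^ k + 1) (toℕ-fromℕ< n%24<24) p∣r2ʲ+1)

repdigit41-residue : ∀ b t → 2 ≤ b → b % 11184810 ≡ 87 → t % 120 ≡ 59 →
                     repdigit b 41 t ≡ sierpinskiResidue mod 11184810
repdigit41-residue b t 2≤b b≡87 t≡59 = begin
  repdigit b 41 t     ≡⟨ repdigit≡k*repunit b 41 t 2≤b ⟩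
  41 * repunit b t    ≈⟨ *-congˡ-mod 41 (repunit-congˡ-mod t (mk≡mod b≡87)) ⟩
  41 * repunit 87 t   ≈⟨ *-congˡ-mod 41 (repunit-periodic 87 59 120 t K∣87⁵⁹R₁₂₀ t≡59) ⟩
  41 * repunit 87 59  ≈⟨ mk≡mod refl ⟩
  sierpinskiResidue   ∎
  where
  open ≡-mod-Reasoning
  -- 87^59 supplies the factor 3; R_87(120) is a sum of 120 odd terms; and for the other
  -- primes q of K, q ∤ 86 while the order of 87 mod q divides 120.
  K∣87⁵⁹R₁₂₀ : 11184810 ∣ 87 ^ 59 * repunit 87 120
  K∣87⁵⁹R₁₂₀ = from-yes (11184810 ∣? 87 ^ 59 * repunit 87 120)

theorem3p9 : (b t : ℕ) → 2 ≤ b → b % 11184810 ≡ 87 → 1 ≤ t → t % 120 ≡ 59 →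
    Sierpinski (repdigit b 41 t)
theorem3p9 b t 2≤b b≡87 _ t≡59 =
  sierpinski-residue-class (repdigit b 41 t) (repdigit41-residue b t 2≤b b≡87 t≡59)
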